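{- Let $m\ge 2$ be even and $l\ge 1$, and let $P_m^*$ be the directed path with vertices $0,1,\ldots,m-1$ and arcs $(0,1),(1,2),\ldots,(m-2,m-1)$. Define subsets of $\mathbb{Z}_{(m-1)l^2+1}$ by $A_i=\{il^2/2+jl : 0\le j\le l-1\}$ for $i$ even and $A_i=\{(m-\tfrac{i+1}{2})l^2-j : 0\le j\le l-1\}$ for $i$ odd ($0\le i\le m-1$). Then $(A_0,\ldots,A_{m-1})$ is an $((m-1)l^2+1,m,l,1;P_m^*)$-EDF in $\mathbb{Z}_{(m-1)l^2+1}$.
   Context: $\Delta(A,B)=\{a-b:a\in A,b\in B\}$ (multiset). For a group $\Gamma$ of order $N$ and a digraph $H$ on vertices $\{0,\ldots,m-1\}$, a family $(A_0,\ldots,A_{m-1})$ of pairwise disjoint $l$-subsets of $\Gamma$ is an $(N,m,l,\lambda;H)$-EDF if $\bigcup_{(i,j)\in\overrightarrow{E}(H)}\Delta(A_j,A_i)=\lambda(\Gamma\setminus\{0\})$ as multisets. -}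

module Defs where

open import Data.Nat using (ℕ; zero; suc; _+_; _*_; _∸_; _/_; _%_)
open import Data.Nat.DivMod using (_mod_)
open import Data.Fin using (Fin; zero; suc; toℕ)
open import Data.List using (List; []; _∷_; map; concatMap; concat; replicate; allFin)
open import Data.List.Relation.Binary.Permutation.Propositional using (_↭_)
open import Data.Product using (_×_; _,_)
open import Relation.Binary.PropositionalEquality using (_≡_; _≢_)
open import Function.Definitions using (Injective)

-- The cyclic group Z_N with N = suc n, elements represented by Fin (suc n).
ℤ/ : ℕ → Set
ℤ/ n = Fin (suc n)

sub : {n : ℕ} → ℤ/ n → ℤ/ n → ℤ/ n
sub {n} a b = (toℕ a + (suc n ∸ toℕ b)) mod (suc n)

-- Δ(A,B) = [ a - b | a ∈ A, b ∈ B ] as a multiset (list); l-subsets given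
-- by (injective) enumerations Fin l → Z_N.
Δ : {n l : ℕ} → (Fin l → ℤ/ n) → (Fin l → ℤ/ n) → List (ℤ/ n)
Δ {l = l} A B = concatMap (λ a → map (λ b → sub (A a) (B b)) (allFin l)) (allFin l)

nonzero : (n : ℕ) → List (ℤ/ n)
nonzero n = map suc (allFin n)

Digraph : ℕ → Set
Digraph m = List (Fin m × Fin m)

-- (N,m,l,λ;H)-EDF in Z_N with N = suc n:
-- pairwise disjoint l-subsets A_0,…,A_{m-1} with
-- ⋃_{(i,j) ∈ E(H)} Δ(A_j , A_i) = λ (Z_N ∖ {0}) as multisets.
IsEDF : (n m l λ' : ℕ) → Digraph m → (Fin m → Fin l → ℤ/ n) → Set
IsEDF n m l λ' H A =
  (∀ i → Injective _≡_ _≡_ (A i))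
  × (∀ i j → i ≢ j → ∀ x y → A i x ≢ A j y)
  × (concatMap (λ { (i , j) → Δ (A j) (A i) }) H ↭ concat (replicate λ' (nonzero n)))

pathArcs : (m : ℕ) → Digraph m
pathArcs zero = []
pathArcs (suc zero) = []
pathArcs (suc (suc k)) = (zero , suc zero) ∷ map (λ { (a , b) → (suc a , suc b) }) (pathArcs (suc k))

-- integer value of the j-th element of A_i (before reduction mod N):
--   i even : i l²/2 + j l ;   i odd : (m - (i+1)/2) l² - j
eltℕ : (m l i j : ℕ) → ℕ
eltℕ m l i j with i % 2
... | zero  = (i / 2) * (l * l) + j * l
... | suc _ = (m ∸ ((i + 1) / 2)) * (l * l) ∸ j

Afam : (m l : ℕ) → Fin m → Fin l → ℤ/ ((m ∸ 1) * (l * l))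
Afam m l i j = eltℕ m l (toℕ i) (toℕ j) mod (suc ((m ∸ 1) * (l * l)))

{-# OPTIONS --safe #-}
module Submission where

-- Write m = 2(p+1), L = l² and N = (2p+1)L + 1. The elements of A_{2h} are jl + hL and
-- those of A_{2h+1} are (m−h−1)L − j (j < l); read in base L they are all distinct and
-- below N. Along the arc (2g, 2g+1) the differences are (2p+1−2g)L − r, and along the
-- arc (2h+1, 2h+2) they are (2h+1)L + 1 + r modulo N, where r = b + al ranges over [0, L).
-- Hence every block {kL+1, …, (k+1)L}, k ≤ 2p, of ℤ_N ∖ {0} is covered by one arc, and
-- since there are only (m−1)L = N − 1 differences, each nonzero element occurs once.

open import Defs
open import Data.Nat using (ℕ; zero; suc; _+_; _*_; _∸_; _≤_; _<_; s≤s; s≤s⁻¹; z≤n; NonZero; _/_; _%_)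
open import Data.Nat.Properties
open import Data.Nat.DivMod
open import Data.Nat.Divisibility using (_∣_; divides)
open import Data.Nat.Tactic.RingSolver using (solve-∀)
open import Data.Fin using (Fin; zero; suc; toℕ; fromℕ<; inject₁)
open import Data.Fin.Properties using (toℕ-fromℕ<; toℕ-injective; toℕ<n; toℕ-inject₁)
import Data.Fin.Properties as Fin
open import Data.List using (List; []; _∷_; _++_; map; concatMap; concat; replicate; length; allFin)
open import Data.List.Properties using (length-map; length-++; length-tabulate; ++-identityʳ)
open import Data.List.Membership.Propositional using (_∈_)
open import Data.List.Membership.Propositional.Properties using (∈-∃++; ∈-map⁺; ∈-map⁻; ∈-concatMap⁺; ∈-allFin)
open import Data.List.Relation.Unary.Any using (here; there)
import Data.List.Relation.Unary.Any as Any
import Data.List.Relation.Unary.All as All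
open import Data.List.Relation.Unary.Unique.Propositional using (Unique; _∷_)
open import Data.List.Relation.Unary.Unique.Propositional.Properties using (map⁺; allFin⁺)
open import Data.List.Relation.Binary.Subset.Propositional using (_⊆_)
open import Data.List.Relation.Binary.Permutation.Propositional using (_↭_; ↭-refl; ↭-trans; prep)
open import Data.List.Relation.Binary.Permutation.Propositional.Properties using (shift; ↭-length; ∈-resp-↭)
open import Data.Product using (_×_; _,_; proj₁; proj₂; ∃-syntax)
open import Function.Base using (_∘_)
open import Relation.Nullary using (contradiction)
open import Relation.Binary.PropositionalEquality using (_≡_; _≢_; refl; sym; trans; cong; cong₂; subst; module ≡-Reasoning)

module _ {a} {A : Set a} where

  unique-⊆⇒↭-++ : ∀ {xs ys : List A} → Unique xs → xs ⊆ ys → ∃[ zs ] ys ↭ xs ++ zs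
  unique-⊆⇒↭-++ {[]} {ys} _ _ = ys , ↭-refl
  unique-⊆⇒↭-++ {x ∷ xs} (x∉xs ∷ xs!) x∷xs⊆ys with ∈-∃++ (x∷xs⊆ys (here refl))
  ... | us , vs , refl =
    let zs , us++vs↭xs++zs = unique-⊆⇒↭-++ xs! xs⊆us++vs
    in zs , ↭-trans (shift x us vs) (prep x us++vs↭xs++zs)
    where
    xs⊆us++vs : xs ⊆ us ++ vs
    xs⊆us++vs y∈xs with ∈-resp-↭ (shift x us vs) (x∷xs⊆ys (there y∈xs))
    ... | here refl      = contradiction refl (All.lookup x∉xs y∈xs)
    ... | there y∈us++vs = y∈us++vs

  unique-⊆-length⇒↭ : ∀ {xs ys : List A} → Unique xs → xs ⊆ ys → length ys ≡ length xs → ys ↭ xs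
  unique-⊆-length⇒↭ {xs} xs! xs⊆ys |ys|≡|xs| with unique-⊆⇒↭-++ xs! xs⊆ys
  ... | [] , ys↭xs++[] = subst (_ ↭_) (++-identityʳ xs) ys↭xs++[]
  ... | z ∷ zs , ys↭xs++z∷zs = contradiction
        (trans (sym (length-++ xs)) (trans (sym (↭-length ys↭xs++z∷zs)) |ys|≡|xs|))
        (m+1+n≢m (length xs))

length-concatMap-const : ∀ {a b} {A : Set a} {B : Set b} (f : A → List B) {c} →
                         (∀ x → length (f x) ≡ c) → ∀ xs → length (concatMap f xs) ≡ length xs * c
length-concatMap-const f |f|≡c []       = refl
length-concatMap-const f |f|≡c (x ∷ xs) =
  trans (length-++ (f x)) (cong₂ _+_ (|f|≡c x) (length-concatMap-const f |f|≡c xs))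

length-allFin : ∀ n → length (allFin n) ≡ n
length-allFin n = length-tabulate {n = n} (λ i → i)

toℕ-sub : ∀ {n} (x y : ℤ/ n) {t} c → t < suc n → t + toℕ y ≡ toℕ x + c * suc n → toℕ (sub x y) ≡ t
toℕ-sub {n} x y {t} c t<N t+y≡x+cN = begin
  toℕ (sub x y)    ≡⟨ toℕ-fromℕ< _ ⟩
  D % N            ≡⟨ [m+kn]%n≡m%n D c N ⟨
  (D + c * N) % N  ≡⟨ cong (_% N) D+cN≡t+N ⟩
  (t + N) % N      ≡⟨ [m+n]%n≡m%n t N ⟩
  t % N            ≡⟨ m<n⇒m%n≡m t<N ⟩
  t                ∎
  where
  open ≡-Reasoning
  N = suc n
  D = toℕ x + (N ∸ toℕ y)
  D+cN≡t+N : D + c * N ≡ t + N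
  D+cN≡t+N = +-cancelʳ-≡ (toℕ y) _ _ (begin
    toℕ x + (N ∸ toℕ y) + c * N + toℕ y    ≡⟨ regroup (toℕ x) (N ∸ toℕ y) (c * N) (toℕ y) ⟩
    toℕ x + c * N + ((N ∸ toℕ y) + toℕ y)  ≡⟨ cong₂ _+_ (sym t+y≡x+cN) (m∸n+n≡m (<⇒≤ (toℕ<n y))) ⟩
    t + toℕ y + N                          ≡⟨ swap t (toℕ y) N ⟩
    t + N + toℕ y                          ∎)
    where
    regroup : ∀ a b c d → a + b + c + d ≡ a + c + (b + d)
    regroup = solve-∀
    swap : ∀ a b c → a + b + c ≡ a + c + b
    swap = solve-∀


∈-Δ : ∀ {n l} (A B : Fin l → ℤ/ n) a b → sub (A a) (B b) ∈ Δ A B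
∈-Δ A B a b = ∈-concatMap⁺ _ (Any.map (λ { refl → ∈-map⁺ _ (∈-allFin b) }) (∈-allFin a))

length-Δ : ∀ {n l} (A B : Fin l → ℤ/ n) → length (Δ A B) ≡ l * l
length-Δ {l = l} A B = begin
  length (Δ A B)          ≡⟨ length-concatMap-const _ |row|≡l (allFin l) ⟩
  length (allFin l) * l   ≡⟨ cong (_* l) (length-allFin l) ⟩
  l * l                   ∎
  where
  open ≡-Reasoning
  |row|≡l : ∀ a → length (map (λ b → sub (A a) (B b)) (allFin l)) ≡ l
  |row|≡l a = trans (length-map _ (allFin l)) (length-allFin l)

arcDifferences : ∀ {n m l} → Digraph m → (Fin m → Fin l → ℤ/ n) → List (ℤ/ n)
arcDifferences H A = concatMap (λ { (i , j) → Δ (A j) (A i) }) H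

∈-arcDifferences : ∀ {n m l} {H : Digraph m} {i j} (A : Fin m → Fin l → ℤ/ n) a b →
                   (i , j) ∈ H → sub (A j a) (A i b) ∈ arcDifferences H A
∈-arcDifferences {i = i} {j} A a b ij∈H =
  ∈-concatMap⁺ _ (Any.map (λ { refl → ∈-Δ (A j) (A i) a b }) ij∈H)

length-arcDifferences : ∀ {n m l} (H : Digraph m) (A : Fin m → Fin l → ℤ/ n) →
                        length (arcDifferences H A) ≡ length H * (l * l)
length-arcDifferences H A = length-concatMap-const _ (λ { (i , j) → length-Δ (A j) (A i) }) H

∈-pathArcs : ∀ {k} (i : Fin k) → (inject₁ i , suc i) ∈ pathArcs (suc k)
∈-pathArcs {suc k} zero    = here refl
∈-pathArcs {suc k} (suc i) = there (∈-map⁺ _ (∈-pathArcs i))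

length-pathArcs : ∀ k → length (pathArcs (suc k)) ≡ k
length-pathArcs zero    = refl
length-pathArcs (suc k) = cong suc (trans (length-map _ (pathArcs (suc k))) (length-pathArcs k))

covering⇒↭nonzero : ∀ {n} (xs : List (ℤ/ n)) → length xs ≡ n → (∀ y → suc y ∈ xs) →
                    xs ↭ concat (replicate 1 (nonzero n))
covering⇒↭nonzero {n} xs |xs|≡n covering =
  subst (xs ↭_) (sym (++-identityʳ (nonzero n)))
    (unique-⊆-length⇒↭ (map⁺ Fin.suc-injective (allFin⁺ n)) nonzero⊆xs
      (trans |xs|≡n (sym (trans (length-map suc (allFin n)) (length-allFin n)))))
  where
  nonzero⊆xs : nonzero n ⊆ xs
  nonzero⊆xs x∈nonzero with ∈-map⁻ suc x∈nonzero
  ... | y , _ , refl = covering y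

divMod-unique : ∀ {d} .{{_ : NonZero d}} {r₁ q₁ r₂ q₂} → r₁ < d → r₂ < d →
                r₁ + q₁ * d ≡ r₂ + q₂ * d → r₁ ≡ r₂ × q₁ ≡ q₂
divMod-unique {d} {r₁} {q₁} {r₂} {q₂} r₁<d r₂<d eq =
  r₁≡r₂ , *-cancelʳ-≡ q₁ q₂ d (+-cancelˡ-≡ r₂ _ _ (subst (λ r → r + q₁ * d ≡ _) r₁≡r₂ eq))
  where
  open ≡-Reasoning
  r₁≡r₂ : r₁ ≡ r₂
  r₁≡r₂ = begin
    r₁                ≡⟨ m<n⇒m%n≡m r₁<d ⟨
    r₁ % d            ≡⟨ [m+kn]%n≡m%n r₁ q₁ d ⟨
    (r₁ + q₁ * d) % d ≡⟨ cong (_% d) eq ⟩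
    (r₂ + q₂ * d) % d ≡⟨ [m+kn]%n≡m%n r₂ q₂ d ⟩
    r₂ % d            ≡⟨ m<n⇒m%n≡m r₂<d ⟩
    r₂                ∎

m<o⇒n<o⇒m+n*o<o*o : ∀ {m n o} → m < o → n < o → m + n * o < o * o
m<o⇒n<o⇒m+n*o<o*o {m} {n} {o} m<o n<o = begin-strict
  m + n * o  <⟨ +-monoˡ-< (n * o) m<o ⟩
  o + n * o  ≤⟨ *-monoˡ-≤ o n<o ⟩
  o * o      ∎
  where open ≤-Reasoning

data ParityView : ℕ → Set where
  even : ∀ h → ParityView (h * 2)
  odd  : ∀ h → ParityView (suc (h * 2))

parityView : ∀ i → ParityView i
parityView zero = even 0
parityView (suc i) with parityView i
... | even h = odd h
... | odd h  = even (suc h)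

eltℕ-even : ∀ m l h j → eltℕ m l (h * 2) j ≡ j * l + h * (l * l)
eltℕ-even m l h j rewrite m*n%n≡0 h 2 {{_}} | m*n/n≡m h 2 {{_}} = +-comm (h * (l * l)) (j * l)

-- Stated additively, so that no truncated subtraction is left.
eltℕ-odd : ∀ {m} l h {j} → suc (h * 2) < m → j ≤ l * l →
           eltℕ m l (suc (h * 2)) j + (j + suc h * (l * l)) ≡ m * (l * l)
eltℕ-odd {m} l h {j} i<m j≤L
  rewrite [m+kn]%n≡m%n 1 h 2 {{_}}
        | trans (cong (_/ 2) (+-comm (suc (h * 2)) 1)) (m*n/n≡m (suc h) 2) = begin
  (m ∸ suc h) * L ∸ j + (j + suc h * L)   ≡⟨ +-assoc ((m ∸ suc h) * L ∸ j) j _ ⟨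
  (m ∸ suc h) * L ∸ j + j + suc h * L     ≡⟨ cong (_+ suc h * L) (m∸n+n≡m j≤[m∸1+h]L) ⟩
  (m ∸ suc h) * L + suc h * L             ≡⟨ *-distribʳ-+ L (m ∸ suc h) (suc h) ⟨
  (m ∸ suc h + suc h) * L                 ≡⟨ cong (_* L) (m∸n+n≡m (<⇒≤ 1+h<m)) ⟩
  m * L                                   ∎
  where
  open ≡-Reasoning
  L = l * l
  1+h<m : suc h < m
  1+h<m = ≤-<-trans (s≤s (m≤m*n h 2)) i<m
  j≤[m∸1+h]L : j ≤ (m ∸ suc h) * L
  j≤[m∸1+h]L = ≤-trans j≤L
    (subst (_≤ (m ∸ suc h) * L) (*-identityˡ L) (*-monoˡ-≤ L (m<n⇒0<n∸m 1+h<m)))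

module Construction (p l′ : ℕ) where

  m = suc p * 2
  l = suc l′
  L = l * l
  n = suc (p * 2) * L

  A : Fin m → Fin l → ℤ/ n
  A = Afam m l

  half≤p : ∀ {h} → h * 2 < m → h ≤ p
  half≤p {h} 2h<m = s≤s⁻¹ (*-cancelʳ-< 2 h (suc p) 2h<m)

  j<L : ∀ {j} → j < l → j < L
  j<L j<l = <-≤-trans j<l (m≤m*n l l)

  jl<L : ∀ {j} → j < l → j * l < L
  jl<L = m<o⇒n<o⇒m+n*o<o*o {0} (s≤s z≤n)

  eltℕ≤n : ∀ {i j} → i < m → j < l → eltℕ m l i j ≤ n
  eltℕ≤n {i} {j} i<m j<l with parityView i
  ... | even h = begin
    eltℕ m l (h * 2) j  ≡⟨ eltℕ-even m l h j ⟩
    j * l + h * L       ≤⟨ +-monoˡ-≤ (h * L) (<⇒≤ (jl<L j<l)) ⟩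
    L + h * L           ≤⟨ *-monoˡ-≤ L (s≤s (≤-trans (half≤p {h} i<m) (m≤m*n p 2))) ⟩
    n                   ∎
    where open ≤-Reasoning
  ... | odd h = +-cancelʳ-≤ L _ _ (begin
    eltℕ m l (suc (h * 2)) j + L                  ≤⟨ +-monoʳ-≤ _ (≤-trans (m≤m+n L (h * L)) (m≤n+m _ j)) ⟩
    eltℕ m l (suc (h * 2)) j + (j + suc h * L)    ≡⟨ eltℕ-odd l h i<m (<⇒≤ (j<L j<l)) ⟩
    L + n                                         ≡⟨ +-comm L n ⟩
    n + L                                         ∎)
    where open ≤-Reasoning

  toℕ-A : ∀ i j → toℕ (A i j) ≡ eltℕ m l (toℕ i) (toℕ j)
  toℕ-A i j = trans (toℕ-fromℕ< _) (m<n⇒m%n≡m (s≤s (eltℕ≤n (toℕ<n i) (toℕ<n j))))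

  eltℕ-even≢odd : ∀ h₁ h₂ {j₁ j₂} → h₁ * 2 < m → suc (h₂ * 2) < m → j₁ < l → j₂ < l →
                  eltℕ m l (h₁ * 2) j₁ ≢ eltℕ m l (suc (h₂ * 2)) j₂
  eltℕ-even≢odd h₁ h₂ {j₁} {j₂} i₁<m i₂<m j₁<l j₂<l eq =
    <-irrefl (proj₂ (divMod-unique (m<o⇒n<o⇒m+n*o<o*o j₂<l j₁<l) (s≤s z≤n) digits)) h₁+1+h₂<m
    where
    open ≡-Reasoning
    regroup : ∀ a b c d e → b + a + (c + suc d) * e ≡ a + c * e + (b + suc d * e)
    regroup = solve-∀
    digits : j₂ + j₁ * l + (h₁ + suc h₂) * L ≡ 0 + m * L
    digits = begin
      j₂ + j₁ * l + (h₁ + suc h₂) * L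
        ≡⟨ regroup (j₁ * l) j₂ h₁ h₂ L ⟩
      j₁ * l + h₁ * L + (j₂ + suc h₂ * L)
        ≡⟨ cong (_+ (j₂ + suc h₂ * L)) (trans (sym (eltℕ-even m l h₁ j₁)) eq) ⟩
      eltℕ m l (suc (h₂ * 2)) j₂ + (j₂ + suc h₂ * L)
        ≡⟨ eltℕ-odd l h₂ i₂<m (<⇒≤ (j<L j₂<l)) ⟩
      m * L
        ∎
    twice : ∀ x → x + x ≡ x * 2
    twice = solve-∀
    h₁+1+h₂<m : h₁ + suc h₂ < m
    h₁+1+h₂<m = subst (h₁ + suc h₂ <_) (twice (suc p))
      (+-mono-<-≤ (s≤s (half≤p {h₁} i₁<m)) (s≤s (half≤p {h₂} (<-trans (n<1+n _) i₂<m))))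

  eltℕ-injective : ∀ {i₁ i₂ j₁ j₂} → i₁ < m → i₂ < m → j₁ < l → j₂ < l →
                   eltℕ m l i₁ j₁ ≡ eltℕ m l i₂ j₂ → i₁ ≡ i₂ × j₁ ≡ j₂
  eltℕ-injective {i₁} {i₂} {j₁} {j₂} i₁<m i₂<m j₁<l j₂<l eq with parityView i₁ | parityView i₂
  ... | even h₁ | even h₂ =
    let j₁l≡j₂l , h₁≡h₂ = divMod-unique {q₁ = h₁} {q₂ = h₂} (jl<L j₁<l) (jl<L j₂<l)
                            (trans (sym (eltℕ-even m l h₁ j₁)) (trans eq (eltℕ-even m l h₂ j₂)))
    in cong (_* 2) h₁≡h₂ , *-cancelʳ-≡ j₁ j₂ l j₁l≡j₂l
  ... | odd h₁  | odd h₂  =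
    let j₁≡j₂ , 1+h₁≡1+h₂ = divMod-unique {q₁ = suc h₁} {q₂ = suc h₂} (j<L j₁<l) (j<L j₂<l)
                              (+-cancelˡ-≡ (eltℕ m l (suc (h₁ * 2)) j₁) _ _
                                (trans (eltℕ-odd l h₁ i₁<m (<⇒≤ (j<L j₁<l)))
                                  (trans (sym (eltℕ-odd l h₂ i₂<m (<⇒≤ (j<L j₂<l))))
                                    (cong (_+ (j₂ + suc h₂ * L)) (sym eq)))))
    in cong (λ h → suc (h * 2)) (suc-injective 1+h₁≡1+h₂) , j₁≡j₂
  ... | even h₁ | odd h₂  = contradiction eq (eltℕ-even≢odd h₁ h₂ i₁<m i₂<m j₁<l j₂<l)
  ... | odd h₁  | even h₂ = contradiction (sym eq) (eltℕ-even≢odd h₂ h₁ i₂<m i₁<m j₂<l j₁<l)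

  A-injective : ∀ {i₁ i₂ j₁ j₂} → A i₁ j₁ ≡ A i₂ j₂ → i₁ ≡ i₂ × j₁ ≡ j₂
  A-injective {i₁} {i₂} {j₁} {j₂} eq =
    let i₁≡i₂ , j₁≡j₂ = eltℕ-injective (toℕ<n i₁) (toℕ<n i₂) (toℕ<n j₁) (toℕ<n j₂)
                          (trans (sym (toℕ-A i₁ j₁)) (trans (cong toℕ eq) (toℕ-A i₂ j₂)))
    in toℕ-injective i₁≡i₂ , toℕ-injective j₁≡j₂

  record ArcDifference (t : ℕ) : Set where
    field
      i a b c  : ℕ
      i<m∸1    : i < suc (p * 2)
      a<l      : a < l
      b<l      : b < l
      equation : t + eltℕ m l i b ≡ eltℕ m l (suc i) a + c * suc n

  oddBlockDifference : ∀ h r → suc (h * 2) < suc (p * 2) → r < L →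
                       ArcDifference (suc (r + suc (h * 2) * L))
  oddBlockDifference h r i<m∸1 r<L = record
    { i = suc (h * 2) ; a = a ; b = b ; c = 1
    ; i<m∸1 = i<m∸1 ; a<l = m<n*o⇒m/o<n r<L ; b<l = m%n<n r l
    ; equation = +-cancelʳ-≡ (b + suc h * L) _ _ (begin
        suc (r + k * L) + eltℕ m l k b + (b + suc h * L)
          ≡⟨ +-assoc (suc (r + k * L)) _ _ ⟩
        suc (r + k * L) + (eltℕ m l k b + (b + suc h * L))
          ≡⟨ cong (suc (r + k * L) +_) (eltℕ-odd l h (m<n⇒m<1+n i<m∸1) b≤L) ⟩
        suc (r + k * L) + m * L
          ≡⟨ cong (λ x → suc (x + k * L) + m * L) (m≡m%n+[m/n]*n r l) ⟩
        suc (b + a * l + k * L) + m * L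
          ≡⟨ regroup b (a * l) h p L ⟩
        a * l + suc h * L + 1 * suc n + (b + suc h * L)
          ≡⟨ cong (λ x → x + 1 * suc n + (b + suc h * L)) (eltℕ-even m l (suc h) a) ⟨
        eltℕ m l (suc k) a + 1 * suc n + (b + suc h * L)
          ∎)
    }
    where
    open ≡-Reasoning
    k = suc (h * 2)
    a = r / l
    b = r % l
    b≤L : b ≤ L
    b≤L = <⇒≤ (j<L (m%n<n r l))
    regroup : ∀ b al h p L → suc (b + al + suc (h * 2) * L) + suc p * 2 * L
                             ≡ al + suc h * L + 1 * suc (suc (p * 2) * L) + (b + suc h * L)
    regroup = solve-∀

  evenBlockDifference : ∀ h r → h * 2 < suc (p * 2) → r < L →
                        ArcDifference (suc (r + h * 2 * L))
  evenBlockDifference h r k<m∸1 r<L with m≤n⇒∃[o]m+o≡n (*-cancelʳ-≤ h p 2 (s≤s⁻¹ k<m∸1))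
  ... | g , h+g≡p = record
    { i = g * 2 ; a = a ; b = b ; c = 0
    ; i<m∸1 = s≤s (*-monoˡ-≤ 2 g≤p)
    ; a<l = m%n<n s l ; b<l = m<n*o⇒m/o<n s<L
    ; equation = +-cancelʳ-≡ (a + suc g * L) _ _ (begin
        suc (r + h * 2 * L) + eltℕ m l (g * 2) b + (a + suc g * L)
          ≡⟨ cong (λ x → suc (r + h * 2 * L) + x + (a + suc g * L)) (eltℕ-even m l g b) ⟩
        suc (r + h * 2 * L) + (b * l + g * L) + (a + suc g * L)
          ≡⟨ regroup r h (b * l) g a L ⟩
        a + b * l + suc r + (L + (h + g) * 2 * L)
          ≡⟨ cong₂ (λ x y → x + (L + y * 2 * L)) a+bl+1+r≡L h+g≡p ⟩
        m * L
          ≡⟨ eltℕ-odd l g (s≤s (s≤s (*-monoˡ-≤ 2 g≤p))) (<⇒≤ (j<L (m%n<n s l))) ⟨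
        eltℕ m l (suc (g * 2)) a + (a + suc g * L)
          ≡⟨ cong (_+ (a + suc g * L)) (+-identityʳ (eltℕ m l (suc (g * 2)) a)) ⟨
        eltℕ m l (suc (g * 2)) a + 0 * suc n + (a + suc g * L)
          ∎)
    }
    where
    open ≡-Reasoning
    g≤p : g ≤ p
    g≤p = subst (g ≤_) h+g≡p (m≤n+m g h)
    s = L ∸ suc r
    s<L : s < L
    s<L = ∸-monoʳ-< (s≤s z≤n) r<L
    a = s % l
    b = s / l
    a+bl+1+r≡L : a + b * l + suc r ≡ L
    a+bl+1+r≡L = trans (cong (_+ suc r) (sym (m≡m%n+[m/n]*n s l))) (m∸n+n≡m r<L)
    regroup : ∀ r h bl g a L → suc (r + h * 2 * L) + (bl + g * L) + (a + suc g * L)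
                               ≡ a + bl + suc r + (L + (h + g) * 2 * L)
    regroup = solve-∀

  blockDifference : ∀ k r → k < suc (p * 2) → r < L → ArcDifference (suc (r + k * L))
  blockDifference k r with parityView k
  ... | even h = evenBlockDifference h r
  ... | odd h  = oddBlockDifference h r

  arcDifference : ∀ v → v < n → ArcDifference (suc v)
  arcDifference v v<n = subst (ArcDifference ∘ suc) (sym (m≡m%n+[m/n]*n v L))
    (blockDifference (v / L) (v % L) (m<n*o⇒m/o<n v<n) (m%n<n v L))

  suc∈arcDifferences : ∀ y → suc y ∈ arcDifferences (pathArcs m) A
  suc∈arcDifferences y =
    subst (_∈ arcDifferences (pathArcs m) A) (toℕ-injective toℕ-sub≡1+y)
      (∈-arcDifferences A a′ b′ (∈-pathArcs i′))
    where
    open ArcDifference (arcDifference (toℕ y) (toℕ<n y))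
    open ≡-Reasoning
    i′ = fromℕ< i<m∸1
    a′ = fromℕ< a<l
    b′ = fromℕ< b<l
    toℕ-A≡ : ∀ {i₀ j₀} {i j} → toℕ i₀ ≡ i → toℕ j₀ ≡ j → toℕ (A i₀ j₀) ≡ eltℕ m l i j
    toℕ-A≡ {i₀} {j₀} refl refl = toℕ-A i₀ j₀
    toℕ-sub≡1+y : toℕ (sub (A (suc i′) a′) (A (inject₁ i′) b′)) ≡ suc (toℕ y)
    toℕ-sub≡1+y = toℕ-sub _ _ c (s≤s (toℕ<n y)) (begin
      suc (toℕ y) + toℕ (A (inject₁ i′) b′)
        ≡⟨ cong (suc (toℕ y) +_) (toℕ-A≡ (trans (toℕ-inject₁ i′) (toℕ-fromℕ< i<m∸1)) (toℕ-fromℕ< b<l)) ⟩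
      suc (toℕ y) + eltℕ m l i b
        ≡⟨ equation ⟩
      eltℕ m l (suc i) a + c * suc n
        ≡⟨ cong (_+ c * suc n) (toℕ-A≡ (cong suc (toℕ-fromℕ< i<m∸1)) (toℕ-fromℕ< a<l)) ⟨
      toℕ (A (suc i′) a′) + c * suc n
        ∎)

  isEDF : IsEDF n m l 1 (pathArcs m) A
  isEDF = (λ i {j₁} {j₂} → proj₂ ∘ A-injective {i} {i} {j₁} {j₂})
        , (λ i₁ i₂ i₁≢i₂ j₁ j₂ → i₁≢i₂ ∘ proj₁ ∘ A-injective {i₁} {i₂} {j₁} {j₂})
        , covering⇒↭nonzero _ |differences|≡n suc∈arcDifferences
    where
    |differences|≡n : length (arcDifferences (pathArcs m) A) ≡ n
    |differences|≡n = trans (length-arcDifferences (pathArcs m) A)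
                            (cong (_* L) (length-pathArcs (suc (p * 2))))

theorem6p1 : (m l : ℕ) → 2 ≤ m → 2 ∣ m → 1 ≤ l →
    IsEDF ((m ∸ 1) * (l * l)) m l 1 (pathArcs m) (Afam m l)
theorem6p1 .(suc p * 2) (suc l′) _ (divides (suc p) refl) _ = Construction.isEDF p l′
theorem6p1 .(0 * 2)     _        () (divides zero refl)   _
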